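{- Let $\mathcal R\in\langle\mathcal H\rangle_2$ be an $n$-ary relation on $H$ ($n\ge2$), and let $\sim_n$ be the relation on $\mathrm{pr}_n\mathcal R$ given by $a\sim_n b$ iff there is $\mathbf x\in H^{n-1}$ with $(\mathbf x,a),(\mathbf x,b)\in\mathcal R$ (an equivalence relation). Let $(\mathbf x,y)\in\mathcal R$ with $\mathbf x\in H^{n-1}$, $y\in H$. If the $\sim_n$-class containing $y$ has odd cardinality, then $(\mathbf x,y)\in\mathcal R^{\mathrm{par}}$, where $\mathcal R^{\mathrm{par}}=\{(\mathbf u,v)\in\mathcal R:|\{z\in H:(\mathbf u,z)\in\mathcal R\}|\text{ is odd}\}$.
   Context: Standing assumptions: $\mathcal H$ is a finite relational structure with base set $H$ that is 2-rigid (no automorphism of order 2), strongly 2-rectangular, and there is a Mal'tsev operation on $H$ that is a polymorphism of every relation of $\langle\mathcal H\rangle_2$. Here $\langle\mathcal H\rangle_2$ is the set of relations defined by formulas $\exists^{\equiv2}Y_1\cdots\exists^{\equiv2}Y_m\Phi$ with $\Phi$ a conjunction of atomic formulas over relations of $\mathcal H$ and equality, where $\exists^{\equiv2}\mathbf y\,\Phi(\mathbf x,\mathbf y)$ holds at $\mathbf a$ iff the number of $\mathbf b$ with $\Phi(\mathbf a,\mathbf b)$ is odd. Strongly 2-rectangular: every relation in $\langle\mathcal H\rangle_2$ of arity $n\ge2$ is rectangular (for every nonempty $I\subsetneq[n]$, as a binary relation between $\mathrm{pr}_I\mathcal R$ and $\mathrm{pr}_{[n]\setminus I}\mathcal R$,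 $(a,c),(a,d),(b,c)\in\mathcal R$ imply $(b,d)\in\mathcal R$). -}

module Defs where

open import Data.Nat using (ℕ; zero; suc; _+_; _%_; _≤_)
open import Data.Nat using () renaming (_≡ᵇ_ to _==_)
open import Data.Fin using (Fin) renaming (_≟_ to _≟ᶠ_)
open import Data.Vec using (Vec; []; _∷_; _++_; lookup; map; tabulate; _∷ʳ_)
open import Data.List using (List; []; _∷_; concatMap; allFin) renaming (map to mapL)
open import Data.Bool using (Bool; true; false; _∧_; if_then_else_)
open import Data.Bool.ListAction using (all; any)
open import Data.Product using (Σ; ∃; _×_; _,_)
open import Relation.Nullary.Decidable using (⌊_⌋)
open import Relation.Binary.PropositionalEquality using (_≡_)

record Structure : Set where
  field
    k   : ℕ
    r   : ℕ
    ar  : Fin r → ℕ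
    rel : (i : Fin r) → Vec (Fin k) (ar i) → Bool

count : {A : Set} → (A → Bool) → List A → ℕ
count p []       = 0
count p (x ∷ xs) = if p x then suc (count p xs) else count p xs

Odd : ℕ → Set
Odd n = n % 2 ≡ 1

isOdd : ℕ → Bool
isOdd n = (n % 2) == 1

allVecs : (k m : ℕ) → List (Vec (Fin k) m)
allVecs k zero    = [] ∷ []
allVecs k (suc m) = concatMap (λ x → mapL (x ∷_) (allVecs k m)) (allFin k)

module _ (𝓗 : Structure) where
  open Structure 𝓗

  H : Set
  H = Fin k

  Rel : ℕ → Set
  Rel n = Vec H n → Bool

  data Atom (v : ℕ) : Set where
    relA : (i : Fin r) → Vec (Fin v) (ar i) → Atom v
    eqA  : Fin v → Fin v → Atom v

  -- ∃^{≡2} Y_1 ⋯ ∃^{≡2} Y_m Φ  with free variables 0..n-1 and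
  -- quantified variables n..n+m-1, Φ a conjunction of atoms.
  record Formula (n : ℕ) : Set where
    field
      m     : ℕ
      atoms : List (Atom (n + m))

  holdsAtom : {v : ℕ} → Vec H v → Atom v → Bool
  holdsAtom σ (relA i vs) = rel i (map (lookup σ) vs)
  holdsAtom σ (eqA u w)   = ⌊ lookup σ u ≟ᶠ lookup σ w ⌋

  ⟦_⟧ : {n : ℕ} → Formula n → Rel n
  ⟦ φ ⟧ a = isOdd (count (λ b → all (holdsAtom (a ++ b)) (Formula.atoms φ)) (allVecs k (Formula.m φ)))

  InClone : {n : ℕ} → Rel n → Set
  InClone {n} R = Σ (Formula n) λ φ → ∀ a → R a ≡ ⟦ φ ⟧ a

  -- rectangularity w.r.t. every nonempty proper I ⊊ [n]
  -- ((a,c),(a,d),(b,c) ∈ R ⇒ (b,d) ∈ R, with t1=(a,c), t2=(a,d), t3=(b,c), t4=(b,d))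
  Rectangular : {n : ℕ} → Rel n → Set
  Rectangular {n} R =
    (I : Fin n → Bool) → (∃ λ i → I i ≡ true) → (∃ λ j → I j ≡ false) →
    (t₁ t₂ t₃ t₄ : Vec H n) →
    R t₁ ≡ true → R t₂ ≡ true → R t₃ ≡ true →
    (∀ i → I i ≡ true → (lookup t₁ i ≡ lookup t₂ i) × (lookup t₄ i ≡ lookup t₃ i)) →
    (∀ i → I i ≡ false → (lookup t₁ i ≡ lookup t₃ i) × (lookup t₄ i ≡ lookup t₂ i)) →
    R t₄ ≡ true

  StronglyTwoRectangular : Set
  StronglyTwoRectangular = (n : ℕ) → 2 ≤ n → (R : Rel n) → InClone R → Rectangular R

  TwoRigid : Set
  TwoRigid = (σ : H → H) → (∀ x → σ (σ x) ≡ x) →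
             (∀ i (t : Vec H (ar i)) → rel i (map σ t) ≡ rel i t) →
             ∀ x → σ x ≡ x

  IsMaltsev : (H → H → H → H) → Set
  IsMaltsev μ = ∀ x y → (μ x x y ≡ y) × (μ x y y ≡ x)

  Preserves : (H → H → H → H) → {n : ℕ} → Rel n → Set
  Preserves μ {n} R = (t₁ t₂ t₃ : Vec H n) →
    R t₁ ≡ true → R t₂ ≡ true → R t₃ ≡ true →
    R (tabulate (λ i → μ (lookup t₁ i) (lookup t₂ i) (lookup t₃ i))) ≡ true

  MaltsevPolymorphismOfClone : Set
  MaltsevPolymorphismOfClone = Σ (H → H → H → H) λ μ →
    IsMaltsev μ × ((n : ℕ) (R : Rel n) → InClone R → Preserves μ R)

  simLast : {n : ℕ} → Rel (suc n) → H → H → Bool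
  simLast {n} R a b = any (λ x → R (x ∷ʳ a) ∧ R (x ∷ʳ b)) (allVecs k n)

  classSize : {n : ℕ} → Rel (suc n) → H → ℕ
  classSize R y = count (simLast R y) (allFin k)

  Rpar : {n : ℕ} → Rel (suc n) → Vec H n → H → Bool
  Rpar R u v = R (u ∷ʳ v) ∧ isOdd (count (λ z → R (u ∷ʳ z)) (allFin k))

-- Rectangularity of R across the split "first n coordinates | last coordinate"
-- says that two tuples sharing a last entry y have identical fibres. Hence the
-- fibre {z | (x, z) ∈ R} of any x with (x, y) ∈ R is exactly the ∼-class of y,
-- so its size is odd whenever that class is.
module Submission where

open import Defs
open import Data.Nat using (ℕ; zero; suc; _≤_; s≤s; z≤n)
open import Data.Nat using () renaming (_≡ᵇ_ to _==_)
open import Data.Bool using (Bool; true; false; _∧_)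
open import Data.Bool.Properties using (⇔→≡)
open import Data.Fin using (Fin; zero; suc; fromℕ)
open import Data.Vec using (Vec; []; _∷_; _∷ʳ_; lookup)
open import Data.List using (List; []; _∷_; allFin) renaming (map to mapL)
open import Data.List.Membership.Propositional using (_∈_)
open import Data.List.Membership.Propositional.Properties using (∈-concatMap⁺; ∈-allFin; ∈-map⁺)
open import Data.List.Relation.Unary.Any as Any using (here; there)
open import Data.Bool.ListAction using (any)
open import Data.Product using (∃; _×_; _,_)
open import Function.Bundles using (mk⇔)
open import Relation.Binary.PropositionalEquality using (_≡_; refl; trans; cong; cong₂)

count-cong : {A : Set} {p q : A → Bool} → (∀ a → p a ≡ q a) → (xs : List A) →
             count p xs ≡ count q xs
count-cong p≗q []       = refl
count-cong {q = q} p≗q (x ∷ xs) rewrite p≗q x with q x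
... | true  = cong suc (count-cong p≗q xs)
... | false = count-cong p≗q xs

Odd⇒isOdd : (n : ℕ) → Odd n → isOdd n ≡ true
Odd⇒isOdd _ odd = cong (_== 1) odd

any-intro : {A : Set} (p : A → Bool) {x : A} {xs : List A} → x ∈ xs → p x ≡ true →
            any p xs ≡ true
any-intro p {xs = x ∷ xs} (here refl) px rewrite px = refl
any-intro p {xs = y ∷ xs} (there x∈xs) px with p y
... | true  = refl
... | false = any-intro p x∈xs px

any-elim : {A : Set} (p : A → Bool) (xs : List A) → any p xs ≡ true → ∃ λ x → p x ≡ true
any-elim p (y ∷ xs) any≡true with p y in py
... | true  = y , py
... | false = any-elim p xs any≡true

∧-true : {a b : Bool} → a ∧ b ≡ true → (a ≡ true) × (b ≡ true)
∧-true {true} b≡true = refl , b≡true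

∈-allVecs : {k m : ℕ} (v : Vec (Fin k) m) → v ∈ allVecs k m
∈-allVecs {k} {zero}  []      = here refl
∈-allVecs {k} {suc m} (h ∷ v) =
  ∈-concatMap⁺ (λ x → mapL (x ∷_) (allVecs k m))
    (Any.map (λ { refl → ∈-map⁺ (h ∷_) (∈-allVecs v) }) (∈-allFin h))

isLast : {n : ℕ} → Fin (suc n) → Bool
isLast {zero}  zero    = true
isLast {suc n} zero    = false
isLast {suc n} (suc i) = isLast i

isLast-fromℕ : (n : ℕ) → isLast (fromℕ n) ≡ true
isLast-fromℕ zero    = refl
isLast-fromℕ (suc n) = isLast-fromℕ n

module _ {A : Set} where

  lookup-∷ʳ-isLast : {n : ℕ} (xs ys : Vec A n) {a : A} {i : Fin (suc n)} →
                     isLast i ≡ true → lookup (xs ∷ʳ a) i ≡ lookup (ys ∷ʳ a) i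
  lookup-∷ʳ-isLast []       []       {i = zero}  _    = refl
  lookup-∷ʳ-isLast (_ ∷ xs) (_ ∷ ys) {i = suc i} last = lookup-∷ʳ-isLast xs ys last

  lookup-∷ʳ-¬isLast : {n : ℕ} (xs : Vec A n) {a b : A} {i : Fin (suc n)} →
                      isLast i ≡ false → lookup (xs ∷ʳ a) i ≡ lookup (xs ∷ʳ b) i
  lookup-∷ʳ-¬isLast (_ ∷ xs) {i = zero}  _       = refl
  lookup-∷ʳ-¬isLast (_ ∷ xs) {i = suc i} notLast = lookup-∷ʳ-¬isLast xs notLast

module _ (𝓗 : Structure) where
  open Structure 𝓗 using (k)

  rectangular-last : {n : ℕ} {R : Rel 𝓗 (suc (suc n))} → Rectangular 𝓗 R →
                     {x x′ : Vec (H 𝓗) (suc n)} {y z : H 𝓗} →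
                     R (x′ ∷ʳ y) ≡ true → R (x ∷ʳ y) ≡ true → R (x′ ∷ʳ z) ≡ true →
                     R (x ∷ʳ z) ≡ true
  rectangular-last {n} rect {x} {x′} x′y xy x′z =
    rect isLast (fromℕ (suc n) , isLast-fromℕ (suc n)) (zero , refl) _ _ _ _ x′y xy x′z
      (λ _ last → lookup-∷ʳ-isLast x′ x last , lookup-∷ʳ-isLast x x′ last)
      (λ _ notLast → lookup-∷ʳ-¬isLast x′ notLast , lookup-∷ʳ-¬isLast x notLast)

  fibre≡simLast : {n : ℕ} {R : Rel 𝓗 (suc (suc n))} → Rectangular 𝓗 R →
                  {x : Vec (H 𝓗) (suc n)} {y : H 𝓗} → R (x ∷ʳ y) ≡ true →
                  ∀ z → R (x ∷ʳ z) ≡ simLast 𝓗 R y z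
  fibre≡simLast {n} {R} rect {x} {y} xy z = ⇔→≡ (mk⇔ toClass fromClass)
    where
    toClass : R (x ∷ʳ z) ≡ true → simLast 𝓗 R y z ≡ true
    toClass xz = any-intro (λ x′ → R (x′ ∷ʳ y) ∧ R (x′ ∷ʳ z)) (∈-allVecs x)
                   (cong₂ _∧_ xy xz)

    fromClass : simLast 𝓗 R y z ≡ true → R (x ∷ʳ z) ≡ true
    fromClass y∼z with any-elim (λ x′ → R (x′ ∷ʳ y) ∧ R (x′ ∷ʳ z)) (allVecs k (suc n)) y∼z
    ... | x′ , x′yz with ∧-true {R (x′ ∷ʳ y)} x′yz
    ...   | x′y , x′z = rectangular-last rect x′y xy x′z

lemma7p13 : (𝓗 : Structure) → TwoRigid 𝓗 → StronglyTwoRectangular 𝓗 →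
            MaltsevPolymorphismOfClone 𝓗 →
            (n : ℕ) → 1 ≤ n → (R : Rel 𝓗 (suc n)) → InClone 𝓗 R →
            (x : Vec (H 𝓗) n) (y : H 𝓗) → R (x ∷ʳ y) ≡ true →
            Odd (classSize 𝓗 R y) →
            Rpar 𝓗 R x y ≡ true
lemma7p13 𝓗 _ rect _ (suc n) _ R R∈⟨𝓗⟩ x y xy oddClass =
  cong₂ _∧_ xy (trans (cong isOdd fibreSize≡classSize) (Odd⇒isOdd (classSize 𝓗 R y) oddClass))
  where
  fibreSize≡classSize : count (λ z → R (x ∷ʳ z)) (allFin (Structure.k 𝓗)) ≡ classSize 𝓗 R y
  fibreSize≡classSize =
    count-cong (fibre≡simLast 𝓗 (rect (suc (suc n)) (s≤s (s≤s z≤n)) R R∈⟨𝓗⟩) xy) (allFin _)
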